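{- Let $k\geq 1$, $n\geq 0$ and $s\geq 4k$ be integers, and consider search on paths where the target moves at most $k$ steps after each test. Then $$N_p(n,s)\geq (s-4k)2^n+k(2n+4).$$
   Context: Search model: $G$ is a finite graph on vertex set $\{1,\dots,N\}$ with a loop at every vertex. For $\mathcal A\subseteq\{1,\dots,N\}$, $\Gamma_k(\mathcal A)$ is the set of vertices $j$ such that for some $i\in\mathcal A$ there is a path (walk) from $i$ to $j$ in $G$ of length at most $k$. An unknown target occupies a vertex; a searcher performs tests $\mathcal T_1,\dots,\mathcal T_n\subseteq\{1,\dots,N\}$ one after another; test $i$ returns $y_i=1$ if the target currently lies in $\mathcal T_i$ and $y_i=0$ otherwise; after each test the target moves along a walk of length at most $k$. In an (adaptive) strategy, $\mathcal T_i$ may depend on $y_1,\dots,y_{i-1}$. The sets of possible positions are $\mathcal D_0=\{1,\dots,N\}$ and $\mathcal D_i=\Gamma_k(\mathcal T_i\cap\mathcal D_{i-1})$ if $y_i=1$, $\mathcal D_i=\Gamma_k(\mathcal D_{i-1}\setminus\mathcal T_i)$ if $y_i=0$. A strategy with $n$ tests is $(G,s)$-successful if for every sequence of test results, $|\mathcal D_i|\leq s$ for some $i\in\{0,\dots,n\}$. The path $P_N$ has vertex set $\{1,\dots,N\}$, edges $\{i-1,i\}$ for $2\leq i\leq N$, and a loop at every vertex. $N_p(n,s)$ denotes the maximum $N$ such that a $(P_N,s)$-successful strategy with $n$ tests exists. -}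

module Defs where

open import Data.Nat using (ℕ; zero; suc; _≤_; _≟_)
open import Data.Bool using (Bool; true; false; _∧_; _∨_; not)
open import Data.Fin using (Fin; toℕ)
open import Data.Fin.Subset using (Subset; _∩_; ∁; ⊤; ∣_∣)
open import Data.Vec using (tabulate; lookup)
open import Data.Vec.Functional using (foldr)
open import Data.Sum using (_⊎_)
open import Data.Product using (_×_; _,_)
open import Data.Unit using () renaming (⊤ to Unit)
open import Relation.Nullary.Decidable using (⌊_⌋)

-- A finite graph on N vertices (vertex i : Fin N stands for vertex toℕ i + 1),
-- given by a Boolean adjacency relation.
Graph : ℕ → Set
Graph N = Fin N → Fin N → Bool

pathGraph : (N : ℕ) → Graph N
pathGraph N i j = ⌊ toℕ i ≟ toℕ j ⌋ ∨ (⌊ suc (toℕ i) ≟ toℕ j ⌋ ∨ ⌊ toℕ i ≟ suc (toℕ j) ⌋)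

anyFin : {N : ℕ} → (Fin N → Bool) → Bool
anyFin f = foldr _∨_ false f

step : {N : ℕ} → Graph N → Subset N → Subset N
step G A = tabulate λ j → anyFin λ i → lookup A i ∧ G i j

walkEnds : {N : ℕ} → Graph N → ℕ → Subset N → Subset N
walkEnds G zero A = A
walkEnds G (suc m) A = step G (walkEnds G m A)

_∪'_ : {N : ℕ} → Subset N → Subset N → Subset N
A ∪' B = tabulate λ j → lookup A j ∨ lookup B j

Γ : {N : ℕ} → Graph N → ℕ → Subset N → Subset N
Γ G zero A = A
Γ G (suc k) A = Γ G k A ∪' walkEnds G (suc k) A

-- Adaptive strategy with n tests: a first test, and for each answer the rest.
Strategy : ℕ → ℕ → Set
Strategy N zero = Unit
Strategy N (suc n) = Subset N × (Bool → Strategy N n)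

-- For every sequence of results starting from current possible-position set D,
-- some D_i (including the current one) has size ≤ s.
Successful : {N : ℕ} → Graph N → ℕ → ℕ → (n : ℕ) → Subset N → Strategy N n → Set
Successful G k s zero D _ = ∣ D ∣ ≤ s
Successful G k s (suc n) D (T , next) =
  ∣ D ∣ ≤ s ⊎
  (Successful G k s n (Γ G k (T ∩ D)) (next true) ×
   Successful G k s n (Γ G k (D ∩ ∁ T)) (next false))

GSuccessful : {N : ℕ} → Graph N → ℕ → ℕ → (n : ℕ) → Strategy N n → Set
GSuccessful {N} G k s n σ = Successful G k s n ⊤ σ

-- The searcher keeps the possible positions inside an interval [a, b) of the
-- path and asks whether the target lies below a threshold c.  After the move,
-- the two answers leave the target in [a − k, c + k) and [c − k, b + k), so
-- each halving costs 2k, except at an end of the path, where the interval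
-- cannot grow.  Splitting evenly, an interval with e ends at the ends of the
-- path is narrowed down to s positions by n tests as long as its length is at
-- most (s − 4k)·2ⁿ + k·(e·n + 4); the whole path has e = 2.
module Submission where

open import Defs
open import Data.Nat using (ℕ; _≤_; _+_; _*_; _∸_; _^_)
open import Data.Product using (Σ; _×_)

open import Data.Bool using (Bool; true; false; T)
open import Data.Bool.Properties using (T-≡; T-∧; T-∨)
open import Data.Fin using (Fin; toℕ)
import Data.Fin as Fin
open import Data.Fin.Properties using (toℕ<n)
open import Data.Fin.Subset using (Subset; _∈_; _∩_; ∁; ⊤; ∣_∣; inside; outside)
open import Data.Fin.Subset.Properties using (x∈p∩q⁻; x∈∁p⇒x∉p)
open import Data.Nat using (zero; suc; pred; _<_; _<?_; _≟_; _⊓_; z≤n; s≤s)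
open import Data.Nat.Properties
open import Data.Nat.Tactic.RingSolver using (solve-∀)
open import Data.Product using (_,_; proj₁; proj₂; ∃)
open import Data.Sum using (inj₁; inj₂)
open import Data.Unit using (tt) renaming (⊤ to Unit)
open import Data.Vec using ([]; _∷_; lookup; tabulate; here; there)
open import Data.Vec.Properties using (lookup∘tabulate; []=⇒lookup; lookup⇒[]=)
open import Function using (_∘_)
open import Function.Bundles using (Equivalence)
open import Relation.Nullary.Decidable using (⌊_⌋; toWitness; fromWitness)
open import Relation.Binary.PropositionalEquality

private
  variable
    n N a b c : ℕ
    f : Fin n → Bool
    x : Fin n
    A D : Subset N
    G : Graph N

T-lookup⇒∈ : T (lookup D x) → x ∈ D
T-lookup⇒∈ {D = D} {x} h = lookup⇒[]= x D (Equivalence.to T-≡ h)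

∈-tabulate⁻ : x ∈ tabulate f → T (f x)
∈-tabulate⁻ {x = x} {f} x∈ =
  Equivalence.from T-≡ (trans (sym (lookup∘tabulate f x)) ([]=⇒lookup x∈))

∈-tabulate⁺ : T (f x) → x ∈ tabulate f
∈-tabulate⁺ {f = f} {x} h =
  lookup⇒[]= x (tabulate f) (trans (lookup∘tabulate f x) (Equivalence.to T-≡ h))

T-anyFin : (f : Fin n → Bool) → T (anyFin f) → ∃ λ i → T (f i)
T-anyFin {suc n} f h with Equivalence.to T-∨ h
... | inj₁ h₀ = Fin.zero , h₀
... | inj₂ h₁ with T-anyFin (f ∘ Fin.suc) h₁
...   | i , hᵢ = Fin.suc i , hᵢ

∈-step⁻ : x ∈ step G A → ∃ λ i → i ∈ A × T (G i x)
∈-step⁻ x∈ with T-anyFin _ (∈-tabulate⁻ x∈)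
... | i , h with Equivalence.to T-∧ h
...   | i∈A , edge = i , T-lookup⇒∈ i∈A , edge

infix 4 _⊆[_,_⟩

_⊆[_,_⟩ : Subset N → ℕ → ℕ → Set
D ⊆[ a , b ⟩ = ∀ {j} → j ∈ D → a ≤ toℕ j × toℕ j < b

⊆[]-mono : ∀ {a′ b′} → a′ ≤ a → b ≤ b′ → D ⊆[ a , b ⟩ → D ⊆[ a′ , b′ ⟩
⊆[]-mono a′≤a b≤b′ D⊆ j∈ with D⊆ j∈
... | a≤j , j<b = ≤-trans a′≤a a≤j , <-≤-trans j<b b≤b′

⊆[]-tail : ∀ {s} → (s ∷ D) ⊆[ a , b ⟩ → D ⊆[ pred a , pred b ⟩
⊆[]-tail D⊆ j∈ with D⊆ (there j∈)
... | a≤1+j , 1+j<b = pred-mono-≤ a≤1+j , suc[m]≤n⇒m≤pred[n] 1+j<b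

⊆[]⇒∣p∣≤b∸a : (D : Subset N) → D ⊆[ a , b ⟩ → ∣ D ∣ ≤ b ∸ a
⊆[]⇒∣p∣≤b∸a [] _ = z≤n
⊆[]⇒∣p∣≤b∸a {a = a} {b} (outside ∷ D) D⊆ =
  ≤-trans (⊆[]⇒∣p∣≤b∸a D (⊆[]-tail D⊆)) (pred∸pred a b)
  where
  pred∸pred : ∀ a b → pred b ∸ pred a ≤ b ∸ a
  pred∸pred zero b = pred[n]≤n
  pred∸pred (suc a) zero = ≤-reflexive (0∸n≡0 a)
  pred∸pred (suc a) (suc b) = ≤-refl
⊆[]⇒∣p∣≤b∸a (inside ∷ D) D⊆ with D⊆ here
... | z≤n , s≤s _ = s≤s (⊆[]⇒∣p∣≤b∸a D (⊆[]-tail D⊆))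

ShortEdged : Graph N → Set
ShortEdged G = ∀ {i j} → T (G i j) → toℕ j ≤ suc (toℕ i) × toℕ i ≤ suc (toℕ j)

pathGraph-shortEdged : ShortEdged (pathGraph N)
pathGraph-shortEdged {i = i} {j} edge with Equivalence.to T-∨ edge
... | inj₁ i≡j rewrite toWitness {a? = toℕ i ≟ toℕ j} i≡j = n≤1+n _ , n≤1+n _
... | inj₂ edge′ with Equivalence.to T-∨ edge′
...   | inj₁ 1+i≡j rewrite sym (toWitness {a? = suc (toℕ i) ≟ toℕ j} 1+i≡j) =
        ≤-refl , m≤n⇒m≤1+n (n≤1+n _)
...   | inj₂ i≡1+j rewrite toWitness {a? = toℕ i ≟ suc (toℕ j)} i≡1+j =
        m≤n⇒m≤1+n (n≤1+n _) , ≤-refl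

step-⊆[] : ShortEdged G → A ⊆[ a , b ⟩ → step G A ⊆[ pred a , suc b ⟩
step-⊆[] short A⊆ j∈ with ∈-step⁻ j∈
... | i , i∈A , edge with A⊆ i∈A | short edge
...   | a≤i , i<b | j≤1+i , i≤1+j = pred-mono-≤ (≤-trans a≤i i≤1+j) , s≤s (≤-trans j≤1+i i<b)

walkEnds-⊆[] : ShortEdged G → ∀ m → A ⊆[ a , b ⟩ → walkEnds G m A ⊆[ a ∸ m , b + m ⟩
walkEnds-⊆[] {b = b} short zero A⊆ = ⊆[]-mono ≤-refl (m≤m+n b 0) A⊆
walkEnds-⊆[] {a = a} {b} short (suc m) A⊆ =
  ⊆[]-mono (≤-reflexive (sym (pred[m∸n]≡m∸[1+n] a m))) (≤-reflexive (sym (+-suc b m)))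
    (step-⊆[] short (walkEnds-⊆[] short m A⊆))

Γ-⊆[] : ShortEdged G → ∀ k → A ⊆[ a , b ⟩ → Γ G k A ⊆[ a ∸ k , b + k ⟩
Γ-⊆[] short zero A⊆ = walkEnds-⊆[] short zero A⊆
Γ-⊆[] {a = a} {b} short (suc k) A⊆ j∈ with Equivalence.to T-∨ (∈-tabulate⁻ j∈)
... | inj₁ j∈Γ =
  ⊆[]-mono (∸-monoʳ-≤ a (n≤1+n k)) (+-monoʳ-≤ b (n≤1+n k)) (Γ-⊆[] short k A⊆) (T-lookup⇒∈ j∈Γ)
... | inj₂ j∈walk = walkEnds-⊆[] short (suc k) A⊆ (T-lookup⇒∈ j∈walk)

Γ-path-⊆[] : ∀ k → A ⊆[ a , b ⟩ → Γ (pathGraph N) k A ⊆[ a ∸ k , (b + k) ⊓ N ⟩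
Γ-path-⊆[] k A⊆ {j} j∈ with Γ-⊆[] pathGraph-shortEdged k A⊆ j∈
... | a∸k≤j , j<b+k = a∸k≤j , ⊓-glb j<b+k (toℕ<n j)

below : ℕ → Subset N
below c = tabulate λ j → ⌊ toℕ j <? c ⌋

below-∩-⊆[] : D ⊆[ a , b ⟩ → below c ∩ D ⊆[ a , c ⟩
below-∩-⊆[] {D = D} {c = c} D⊆ {j} j∈ with x∈p∩q⁻ (below c) D j∈
... | j∈below , j∈D = proj₁ (D⊆ j∈D) , toWitness {a? = toℕ j <? c} (∈-tabulate⁻ j∈below)

∩-∁below-⊆[] : D ⊆[ a , b ⟩ → D ∩ ∁ (below c) ⊆[ c , b ⟩
∩-∁below-⊆[] {D = D} {c = c} D⊆ {j} j∈ with x∈p∩q⁻ D (∁ (below c)) j∈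
... | j∈D , j∈∁below =
  ≮⇒≥ (λ j<c → x∈∁p⇒x∉p j∈∁below (∈-tabulate⁺ (fromWitness {a? = toℕ j <? c} j<c))) ,
  proj₂ (D⊆ j∈D)

module Search (N k s : ℕ) (4k≤s : 4 * k ≤ s) where

  Succeeds : ℕ → Subset N → Set
  Succeeds n D = Σ (Strategy N n) (Successful (pathGraph N) k s n D)

  finish : D ⊆[ a , b ⟩ → b ≤ a + s → Succeeds 0 D
  finish {D = D} {a} {b} D⊆ b≤a+s = tt , ≤-trans (⊆[]⇒∣p∣≤b∸a D D⊆) (m≤n+o⇒m∸n≤o b a b≤a+s)

  query-below : ∀ c → D ⊆[ a , b ⟩ →
    (∀ {E} → E ⊆[ a ∸ k , (c + k) ⊓ N ⟩ → Succeeds n E) →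
    (∀ {E} → E ⊆[ c ∸ k , (b + k) ⊓ N ⟩ → Succeeds n E) →
    Succeeds (suc n) D
  query-below c D⊆ searchBelow searchAbove
    with searchBelow (Γ-path-⊆[] k (below-∩-⊆[] D⊆))
       | searchAbove (Γ-path-⊆[] k (∩-∁below-⊆[] D⊆))
  ... | σ , σ-ok | τ , τ-ok = (below c , λ { true → σ ; false → τ }) , inj₂ (σ-ok , τ-ok)

  -- A flag marks an end of the current interval that coincides with an end of the path.
  pinned : Bool → ℕ
  pinned true = 1
  pinned false = 0

  Pinnedˡ : Bool → ℕ → Set
  Pinnedˡ true a = a ≡ 0
  Pinnedˡ false _ = Unit

  Pinnedʳ : Bool → ℕ → Set
  Pinnedʳ true b = b ≡ N
  Pinnedʳ false _ = Unit

  pinnedˡ-∸ : ∀ l → Pinnedˡ l a → Pinnedˡ l (a ∸ k)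
  pinnedˡ-∸ true refl = 0∸n≡0 k
  pinnedˡ-∸ false _ = tt

  pinnedʳ-⊓ : ∀ r → Pinnedʳ r b → Pinnedʳ r ((b + k) ⊓ N)
  pinnedʳ-⊓ true refl = m≥n⇒m⊓n≡n (m≤m+n N k)
  pinnedʳ-⊓ false _ = tt

  budget : ℕ → ℕ → ℕ
  budget n e = (s ∸ 4 * k) * 2 ^ n + k * (e * n + 4)

  budget-zero : ∀ e → budget 0 e ≡ s
  budget-zero e = trans (identity (s ∸ 4 * k) k e) (m∸n+n≡m 4k≤s)
    where
    identity : ∀ t k e → t * 1 + k * (e * 0 + 4) ≡ t + 4 * k
    identity = solve-∀

  -- The threshold splitPoint l n a + k is chosen so that both answers fit the budget of n tests.
  splitPoint : Bool → ℕ → ℕ → ℕ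
  splitPoint l n a = a + (s ∸ 4 * k) * 2 ^ n + k * (pinned l * suc n + 1)

  lower-half-fits : ∀ l n → Pinnedˡ l a →
    splitPoint l n a + k + k ≤ a ∸ k + budget n (pinned l + 0)
  lower-half-fits {a} false n _ = begin
    a + P + k * (0 * suc n + 1) + k + k   ≡⟨ unpinned a P k n ⟩
    a + (P + 3 * k)                       ≤⟨ +-monoˡ-≤ (P + 3 * k) (m≤n+m∸n a k) ⟩
    k + (a ∸ k) + (P + 3 * k)             ≡⟨ regroup (a ∸ k) P k n ⟩
    a ∸ k + budget n (0 + 0)              ∎
    where
    open ≤-Reasoning
    P : ℕ
    P = (s ∸ 4 * k) * 2 ^ n
    unpinned : ∀ a P k n → a + P + k * (0 * suc n + 1) + k + k ≡ a + (P + 3 * k)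
    unpinned = solve-∀
    regroup : ∀ a′ P k n → k + a′ + (P + 3 * k) ≡ a′ + (P + k * ((0 + 0) * n + 4))
    regroup = solve-∀
  lower-half-fits true n refl = ≤-reflexive (begin
    0 + P + k * (1 * suc n + 1) + k + k   ≡⟨ pinned-start P k n ⟩
    0 + budget n (1 + 0)                  ≡⟨ cong (_+ budget n 1) (sym (0∸n≡0 k)) ⟩
    0 ∸ k + budget n (1 + 0)              ∎)
    where
    open ≡-Reasoning
    P : ℕ
    P = (s ∸ 4 * k) * 2 ^ n
    pinned-start : ∀ P k n → 0 + P + k * (1 * suc n + 1) + k + k ≡ 0 + (P + k * ((1 + 0) * n + 4))
    pinned-start = solve-∀

  upper-half-fits : ∀ l r n → Pinnedʳ r b → b ≤ a + budget (suc n) (pinned l + pinned r) →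
    (b + k) ⊓ N ≤ splitPoint l n a + budget n (0 + pinned r)
  upper-half-fits {b} {a} l false n _ b≤ = begin
    (b + k) ⊓ N                                 ≤⟨ m⊓n≤m (b + k) N ⟩
    b + k                                       ≤⟨ +-monoˡ-≤ k b≤ ⟩
    a + budget (suc n) (pinned l + 0) + k       ≡⟨ halve a (s ∸ 4 * k) (2 ^ n) k (pinned l) n ⟩
    splitPoint l n a + budget n (0 + 0)         ∎
    where
    open ≤-Reasoning
    halve : ∀ a t x k e n →
      a + (t * (2 * x) + k * ((e + 0) * suc n + 4)) + k ≡
      a + t * x + k * (e * suc n + 1) + (t * x + k * ((0 + 0) * n + 4))
    halve = solve-∀
  upper-half-fits {a = a} l true n refl N≤ = begin
    (N + k) ⊓ N                                 ≤⟨ m⊓n≤n (N + k) N ⟩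
    N                                           ≤⟨ N≤ ⟩
    a + budget (suc n) (pinned l + 1)           ≡⟨ halve a (s ∸ 4 * k) (2 ^ n) k (pinned l) n ⟩
    splitPoint l n a + budget n (0 + 1)         ∎
    where
    open ≤-Reasoning
    halve : ∀ a t x k e n →
      a + (t * (2 * x) + k * ((e + 1) * suc n + 4)) ≡
      a + t * x + k * (e * suc n + 1) + (t * x + k * ((0 + 1) * n + 4))
    halve = solve-∀

  interval-search : ∀ n l r → Pinnedˡ l a → Pinnedʳ r b →
    b ≤ a + budget n (pinned l + pinned r) → D ⊆[ a , b ⟩ → Succeeds n D
  interval-search {a} {b} zero l r _ _ b≤ D⊆ =
    finish D⊆ (subst (λ m → b ≤ a + m) (budget-zero (pinned l + pinned r)) b≤)
  interval-search {a} {b} (suc n) l r pinnedᵃ pinnedᵇ b≤ D⊆ =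
    query-below (d + k) D⊆
      (λ E⊆ → interval-search n l false (pinnedˡ-∸ l pinnedᵃ) tt (lower-half-fits l n pinnedᵃ)
                (⊆[]-mono ≤-refl (m⊓n≤m (d + k + k) N) E⊆))
      (λ E⊆ → interval-search n false r tt (pinnedʳ-⊓ r pinnedᵇ) (upper-half-fits {a = a} l r n pinnedᵇ b≤)
                (⊆[]-mono (≤-reflexive (sym (m+n∸n≡m d k))) ≤-refl E⊆))
    where
    d : ℕ
    d = splitPoint l n a

theorem5 : (k n s : ℕ) → 1 ≤ k → 4 * k ≤ s →
    Σ ℕ λ N → ((s ∸ 4 * k) * 2 ^ n + k * (2 * n + 4) ≤ N) ×
    Σ (Strategy N n) λ σ → GSuccessful (pathGraph N) k s n σ
theorem5 k n s _ 4k≤s = length , ≤-refl , interval-search n true true refl refl ≤-refl whole-path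
  where
  length : ℕ
  length = (s ∸ 4 * k) * 2 ^ n + k * (2 * n + 4)
  open Search length k s 4k≤s
  whole-path : ⊤ ⊆[ 0 , length ⟩
  whole-path {j} _ = z≤n , toℕ<n j
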